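{- For every $n\in\mathbb{N}$, if the principal prefix of $\beta(n)$ has length $r$ and $\beta(n)$ has $s$ ones, then $$h_q(n)=q^{r+s}\,\mathrm{rgf}_n(q^{ -1}).$$
   Context: $h_q(n)=\sum_\eta q^{\ell(\eta)}$ over hyperbinary partitions $\eta$ of $n$ (partitions into powers of $2$, each part used at most twice), $\ell(\eta)$ = number of parts. $\beta(n)=b_1\cdots b_k$ is the binary expansion of $n$, most significant digit first ($\beta(0)$ is the empty word). The principal prefix of $\beta(n)$ is $b_1\cdots b_r$ where $b_{r+1}$ is the rightmost $0$ of $\beta(n)$ (empty, $r=0$, if there is no $0$). The fence $\mathcal{F}(n)$ is the poset on $\{x_1,\dots,x_r\}$ whose covers are, for $2\le i\le r$: $x_i$ covered by $x_{i-1}$ if $b_i=0$, and $x_i$ covers $x_{i-1}$ if $b_i=1$. $\mathcal{J}(\mathcal{F}(n))$ is the set of lower order ideals of $\mathcal{F}(n)$, and $\mathrm{rgf}_n(t)=\sum_{I\in\mathcal{J}(\mathcal{F}(n))}t^{|I|}$. -}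

module Defs where

open import Data.Bool using (Bool; true; false; _∧_; _∨_; not; if_then_else_)
open import Data.Nat using (ℕ; zero; suc; _+_; _*_; _^_; _≟_; _%_; _/_)
open import Data.List using (List; []; _∷_; reverse; length; filter; map; concatMap; foldr)
open import Data.Nat.ListAction using (sum)
open import Data.Rational using (ℚ; 0ℚ; 1ℚ) renaming (_+_ to _+ℚ_; _*_ to _*ℚ_)

infixr 8 _^ℚ_
_^ℚ_ : ℚ → ℕ → ℚ
q ^ℚ zero  = 1ℚ
q ^ℚ suc k = q *ℚ (q ^ℚ k)

sumℚ : List ℚ → ℚ
sumℚ = foldr _+ℚ_ 0ℚ

-- least-significant-bit-first binary digits, with fuel (fuel ≥ n suffices)
revBitsF : ℕ → ℕ → List Bool
revBitsF zero    n = []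
revBitsF (suc f) zero = []
revBitsF (suc f) (suc m) =
  (if (suc m % 2) Data.Nat.≡ᵇ 1 then true else false) ∷ revBitsF f (suc m / 2)

-- β(n) : binary expansion, most significant digit first; β(0) = []
β : ℕ → List Bool
β n = reverse (revBitsF n n)

ones : List Bool → ℕ
ones []            = 0
ones (true  ∷ bs)  = suc (ones bs)
ones (false ∷ bs)  = ones bs

-- principal prefix: b₁⋯b_r where b_{r+1} is the rightmost 0 (empty if no 0).
-- Computed on the reversed word: skip trailing 1s, drop the rightmost 0,
-- the rest (reversed back) is the prefix.
ppRev : List Bool → List Bool
ppRev []            = []
ppRev (true  ∷ xs)  = ppRev xs
ppRev (false ∷ xs)  = xs

principalPrefix : List Bool → List Bool
principalPrefix w = reverse (ppRev (reverse w))

mults : ℕ → List (List ℕ)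
mults zero    = [] ∷ []
mults (suc k) = concatMap (λ cs → (0 ∷ cs) ∷ (1 ∷ cs) ∷ (2 ∷ cs) ∷ []) (mults k)

-- value of a multiplicity list (c_i is the multiplicity of the part 2^(i+j))
valueFrom : ℕ → List ℕ → ℕ
valueFrom j []       = 0
valueFrom j (c ∷ cs) = c * 2 ^ j + valueFrom (suc j) cs

-- hyperbinary partitions of n, encoded by their multiplicity lists
-- (c_0, …, c_n), c_i ∈ {0,1,2} being the number of parts equal to 2^i;
-- parts 2^i with i > n cannot occur since 2^i > n.
hyperbinary : ℕ → List (List ℕ)
hyperbinary n = filter (λ cs → valueFrom 0 cs ≟ n) (mults (suc n))

h : ℚ → ℕ → ℚ
h q n = sumℚ (map (λ cs → q ^ℚ sum cs) (hyperbinary n))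

-- all subsets of {x₁,…,x_r}, as membership lists of length r
subsets : ℕ → List (List Bool)
subsets zero    = [] ∷ []
subsets (suc k) = concatMap (λ s → (false ∷ s) ∷ (true ∷ s) ∷ []) (subsets k)

-- cover condition between x_{i-1} (membership a) and x_i (membership c):
--   b_i = 0 : x_i covered by x_{i-1}, so x_{i-1} ∈ I ⇒ x_i ∈ I
--   b_i = 1 : x_i covers x_{i-1},     so x_i ∈ I ⇒ x_{i-1} ∈ I
coverOK : Bool → Bool → Bool → Bool
coverOK false a c = not a ∨ c
coverOK true  a c = not c ∨ a

isIdealFrom : Bool → List Bool → List Bool → Bool
isIdealFrom a (b ∷ bs) (c ∷ cs) = coverOK b a c ∧ isIdealFrom c bs cs
isIdealFrom a _        _        = true

-- I is a lower order ideal of the fence defined by the word b₁⋯b_r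
-- (closed downward under all cover relations, hence under the order)
isIdeal : List Bool → List Bool → Bool
isIdeal (b₁ ∷ bs) (a ∷ as) = isIdealFrom a bs as
isIdeal _         _        = true

ideals : ℕ → List (List Bool)
ideals n = filter (λ I → isIdeal w I Data.Bool.≟ true) (subsets (length w))
  where w = principalPrefix (β n)

rgf : ℕ → ℚ → ℚ
rgf n t = sumℚ (map (λ I → t ^ℚ ones I) (ideals n))

-- Splitting off the multiplicity of the part 1 gives h(2m+1) = q h(m) and
-- h(2m) = h(m) + q² h(m-1), so appending a binary digit b to n transforms the pair
-- (h(n), q² h(n-1)) by a 2×2 matrix M_b.  The ideals of a fence are counted by a product
-- of 2×2 transfer matrices N_b, one per cover, and for t = 1/q one has q^(1+b) N_b = M_bᵀ.
-- Transposition reverses the order of the product, so q^(|w| + ones w) rgf_w(1/q) = h(w0),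
-- where w0 is the number written as w followed by 0.  Each 1 after this last 0 contributes
-- one more factor q to both sides.
module Submission where

open import Defs
open import Data.Nat using (ℕ; _+_)
open import Data.List using (length)
open import Data.Rational using (ℚ; NonZero; 1/_; _*_)
open import Relation.Binary.PropositionalEquality using (_≡_)

open import Level using (Level)
open import Function using (_∘_)
open import Data.Bool using (Bool; true; false; _∧_; if_then_else_; _≟_)
open import Data.Nat using (zero; suc; _≤_; _<_; z≤n; s≤s; _≡ᵇ_)
import Data.Nat as ℕ
import Data.Nat.Properties as ℕₚ
open import Data.Nat.DivMod using (_%_; _/_; m≡m%n+[m/n]*n; m%n<n; m/n<m; m≥n⇒m/n>0)
open import Data.Nat.ListAction using (sum)
open import Data.List using (List; []; _∷_; _++_; _∷ʳ_; [_]; map; filter; concatMap; reverse; foldr)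
open import Data.List.Properties
  using (map-cong; foldr-∷ʳ; unfold-reverse; reverse-++; reverse-involutive; length-reverse)
open import Data.Product using (_×_; _,_; proj₁; ∃-syntax)
open import Data.Rational using (0ℚ; 1ℚ) renaming (_+_ to _+ℚ_)
import Data.Rational.Properties as ℚₚ
open import Data.Rational.Solver using (module +-*-Solver)
open import Algebra.Bundles using (CommutativeMonoid)
open import Algebra.Properties.CommutativeSemigroup
  (CommutativeMonoid.commutativeSemigroup ℚₚ.+-0-commutativeMonoid) using (interchange)
open import Relation.Binary.PropositionalEquality
  using (refl; sym; trans; cong; cong₂; cong-app; subst; _≢_; module ≡-Reasoning)
open import Relation.Nullary using (does; contradiction)
open import Relation.Unary using (Pred; Decidable)

open ≡-Reasoning
open +-*-Solver using (solve; _:+_; _:*_; _:=_; con)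

private variable
  a p : Level
  A B : Set a

∑ : List A → (A → ℚ) → ℚ
∑ xs f = sumℚ (map f xs)

syntax ∑ xs (λ x → e) = ∑[ x ← xs ] e

∑-cong : ∀ (xs : List A) {f g : A → ℚ} → (∀ x → f x ≡ g x) → ∑ xs f ≡ ∑ xs g
∑-cong xs f≗g = cong sumℚ (map-cong f≗g xs)

∑-++ : ∀ (xs ys : List A) f → ∑ (xs ++ ys) f ≡ ∑ xs f +ℚ ∑ ys f
∑-++ []       ys f = sym (ℚₚ.+-identityˡ _)
∑-++ (x ∷ xs) ys f = trans (cong (f x +ℚ_) (∑-++ xs ys f)) (sym (ℚₚ.+-assoc (f x) _ _))

∑-concatMap : ∀ (g : A → List B) xs f → ∑ (concatMap g xs) f ≡ ∑[ x ← xs ] ∑ (g x) f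
∑-concatMap g []       f = refl
∑-concatMap g (x ∷ xs) f =
  trans (∑-++ (g x) (concatMap g xs) f) (cong (∑ (g x) f +ℚ_) (∑-concatMap g xs f))

∑-+ : ∀ (xs : List A) f g → ∑[ x ← xs ] (f x +ℚ g x) ≡ ∑ xs f +ℚ ∑ xs g
∑-+ []       f g = sym (ℚₚ.+-identityˡ 0ℚ)
∑-+ (x ∷ xs) f g =
  trans (cong (f x +ℚ g x +ℚ_) (∑-+ xs f g)) (interchange (f x) (g x) (∑ xs f) (∑ xs g))

∑-*ˡ : ∀ c (xs : List A) f → ∑[ x ← xs ] (c * f x) ≡ c * ∑ xs f
∑-*ˡ c []       f = sym (ℚₚ.*-zeroʳ c)
∑-*ˡ c (x ∷ xs) f = trans (cong (c * f x +ℚ_) (∑-*ˡ c xs f)) (sym (ℚₚ.*-distribˡ-+ c _ _))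

∑-zero : ∀ (xs : List A) → ∑[ _ ← xs ] 0ℚ ≡ 0ℚ
∑-zero []       = refl
∑-zero (x ∷ xs) = trans (ℚₚ.+-identityˡ _) (∑-zero xs)

∑-if : ∀ c (xs : List A) f → ∑[ x ← xs ] (if c then f x else 0ℚ) ≡ (if c then ∑ xs f else 0ℚ)
∑-if true  xs f = refl
∑-if false xs f = ∑-zero xs

∑-filter : ∀ {P : Pred A p} (P? : Decidable P) xs f →
           ∑ (filter P? xs) f ≡ ∑[ x ← xs ] (if does (P? x) then f x else 0ℚ)
∑-filter P? []       f = refl
∑-filter P? (x ∷ xs) f with does (P? x)
... | true  = cong (f x +ℚ_) (∑-filter P? xs f)
... | false = trans (∑-filter P? xs f) (sym (ℚₚ.+-identityˡ _))

if-*ˡ : ∀ b c x → (if b then c * x else 0ℚ) ≡ c * (if b then x else 0ℚ)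
if-*ˡ true  c x = refl
if-*ˡ false c x = sym (ℚₚ.*-zeroʳ c)

if-∧ : ∀ b c (x : ℚ) → (if b ∧ c then x else 0ℚ) ≡ (if b then (if c then x else 0ℚ) else 0ℚ)
if-∧ true  c x = refl
if-∧ false c x = refl

bitValue : Bool → ℕ
bitValue false = 0
bitValue true  = 1

fromBits : List Bool → ℕ
fromBits []      = 0
fromBits (b ∷ L) = bitValue b + fromBits L ℕ.* 2

βʳ : ℕ → List Bool
βʳ n = revBitsF n n

bitValue-lowBit : ∀ n → bitValue (if n % 2 ≡ᵇ 1 then true else false) ≡ n % 2
bitValue-lowBit n with n % 2 | m%n<n n 2
... | 0           | _               = refl
... | 1           | _               = refl
... | suc (suc _) | s≤s (s≤s ())

[1+m]/2≤m : ∀ m → suc m / 2 ≤ m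
[1+m]/2≤m m = ℕₚ.≤-pred (m/n<m (suc m) 2 (s≤s (s≤s z≤n)))

fromBits-revBitsF : ∀ f n → n ≤ f → fromBits (revBitsF f n) ≡ n
fromBits-revBitsF zero    zero    _         = refl
fromBits-revBitsF (suc f) zero    _         = refl
fromBits-revBitsF (suc f) (suc m) (s≤s m≤f) = begin
    bitValue (if suc m % 2 ≡ᵇ 1 then true else false) + fromBits (revBitsF f (suc m / 2)) ℕ.* 2
  ≡⟨ cong₂ (λ r d → r + d ℕ.* 2) (bitValue-lowBit (suc m))
           (fromBits-revBitsF f (suc m / 2) (ℕₚ.≤-trans ([1+m]/2≤m m) m≤f)) ⟩
    suc m % 2 + (suc m / 2) ℕ.* 2
  ≡⟨ sym (m≡m%n+[m/n]*n (suc m) 2) ⟩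
    suc m ∎

length-revBitsF : ∀ f n → length (revBitsF f n) ≤ f
length-revBitsF zero    n       = z≤n
length-revBitsF (suc f) zero    = z≤n
length-revBitsF (suc f) (suc m) = s≤s (length-revBitsF f (suc m / 2))

-- Least-significant-first digit lists without leading zeros.
data Canonical : List Bool → Set where
  []    : Canonical []
  _∷ʳ1 : ∀ L → Canonical (L ∷ʳ true)

canonical-∷ : ∀ {b L} → Canonical L → L ≢ [] → Canonical (b ∷ L)
canonical-∷     []      L≢[] = contradiction refl L≢[]
canonical-∷ {b} (L ∷ʳ1) _    = (b ∷ L) ∷ʳ1

revBitsF-nonempty : ∀ {f n} → 0 < n → n ≤ f → revBitsF f n ≢ []
revBitsF-nonempty (s≤s _) (s≤s _) ()

revBitsF-canonical : ∀ f n → n ≤ f → Canonical (revBitsF f n)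
revBitsF-canonical zero          _             _            = []
revBitsF-canonical (suc f)       zero          _            = []
revBitsF-canonical (suc zero)    (suc zero)    _            = [] ∷ʳ1
revBitsF-canonical (suc (suc f)) (suc zero)    _            = [] ∷ʳ1
revBitsF-canonical (suc f)       (suc (suc m)) (s≤s 1+m≤f) =
  canonical-∷ (revBitsF-canonical f k k≤f)
              (revBitsF-nonempty (m≥n⇒m/n>0 {suc (suc m)} {2} (s≤s (s≤s z≤n))) k≤f)
  where
  k = suc (suc m) / 2
  k≤f = ℕₚ.≤-trans ([1+m]/2≤m (suc m)) 1+m≤f

data NoLeadingZero : List Bool → Set where
  []  : NoLeadingZero []
  1∷_ : ∀ w → NoLeadingZero (true ∷ w)

reverse-canonical : ∀ {L} → Canonical L → NoLeadingZero (reverse L)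
reverse-canonical []      = []
reverse-canonical (L ∷ʳ1) = subst NoLeadingZero (sym (reverse-++ L [ true ])) (1∷ reverse L)

β-noLeadingZero : ∀ n → NoLeadingZero (β n)
β-noLeadingZero n = reverse-canonical (revBitsF-canonical n n ℕₚ.≤-refl)

noLeadingZero-++ : ∀ u {v} → NoLeadingZero (u ++ v) → NoLeadingZero u
noLeadingZero-++ []      _      = []
noLeadingZero-++ (_ ∷ u) (1∷ _) = 1∷ u

ppRev-suffix : ∀ xs → ∃[ u ] xs ≡ u ++ ppRev xs
ppRev-suffix []           = [] , refl
ppRev-suffix (true  ∷ xs) = let u , eq = ppRev-suffix xs in true ∷ u , cong (true ∷_) eq
ppRev-suffix (false ∷ xs) = [ false ] , refl

principalPrefix-prefix : ∀ w → ∃[ v ] w ≡ principalPrefix w ++ v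
principalPrefix-prefix w = let u , eq = ppRev-suffix (reverse w) in reverse u , (begin
  w                                 ≡⟨ sym (reverse-involutive w) ⟩
  reverse (reverse w)               ≡⟨ cong reverse eq ⟩
  reverse (u ++ ppRev (reverse w))  ≡⟨ reverse-++ u _ ⟩
  principalPrefix w ++ reverse u    ∎)

noLeadingZero-principalPrefix : ∀ {w} → NoLeadingZero w → NoLeadingZero (principalPrefix w)
noLeadingZero-principalPrefix {w} nlz =
  let _ , eq = principalPrefix-prefix w in noLeadingZero-++ (principalPrefix w) (subst NoLeadingZero eq nlz)

principalPrefix-reverse : ∀ L → principalPrefix (reverse L) ≡ reverse (ppRev L)
principalPrefix-reverse L = cong (reverse ∘ ppRev) (reverse-involutive L)

ones-++ : ∀ u v → ones (u ++ v) ≡ ones u + ones v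
ones-++ []          v = refl
ones-++ (true  ∷ u) v = cong suc (ones-++ u v)
ones-++ (false ∷ u) v = ones-++ u v

ones-reverse : ∀ w → ones (reverse w) ≡ ones w
ones-reverse []      = refl
ones-reverse (b ∷ w) = begin
  ones (reverse (b ∷ w))         ≡⟨ cong ones (unfold-reverse b w) ⟩
  ones (reverse w ∷ʳ b)          ≡⟨ ones-++ (reverse w) [ b ] ⟩
  ones (reverse w) + ones [ b ]  ≡⟨ cong (_+ ones [ b ]) (ones-reverse w) ⟩
  ones w + ones [ b ]            ≡⟨ ℕₚ.+-comm (ones w) _ ⟩
  ones [ b ] + ones w            ≡⟨ sym (ones-++ [ b ] w) ⟩
  ones (b ∷ w)                   ∎

*2≡ᵇ*2 : ∀ m n → (m ℕ.* 2 ≡ᵇ n ℕ.* 2) ≡ (m ≡ᵇ n)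
*2≡ᵇ*2 zero    zero    = refl
*2≡ᵇ*2 zero    (suc n) = refl
*2≡ᵇ*2 (suc m) zero    = refl
*2≡ᵇ*2 (suc m) (suc n) = *2≡ᵇ*2 m n

*2≡ᵇ1+*2 : ∀ m n → (m ℕ.* 2 ≡ᵇ suc (n ℕ.* 2)) ≡ false
*2≡ᵇ1+*2 zero    zero    = refl
*2≡ᵇ1+*2 zero    (suc n) = refl
*2≡ᵇ1+*2 (suc m) zero    = refl
*2≡ᵇ1+*2 (suc m) (suc n) = *2≡ᵇ1+*2 m n

1+*2≡ᵇ*2 : ∀ m n → (suc (m ℕ.* 2) ≡ᵇ n ℕ.* 2) ≡ false
1+*2≡ᵇ*2 zero    zero    = refl
1+*2≡ᵇ*2 zero    (suc n) = refl
1+*2≡ᵇ*2 (suc m) zero    = refl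
1+*2≡ᵇ*2 (suc m) (suc n) = 1+*2≡ᵇ*2 m n

valueFrom-suc : ∀ j cs → valueFrom (suc j) cs ≡ valueFrom j cs ℕ.* 2
valueFrom-suc j []       = refl
valueFrom-suc j (c ∷ cs) = begin
  c ℕ.* 2 ℕ.^ suc j + valueFrom (suc (suc j)) cs    ≡⟨ cong₂ _+_ c*[2*p]≡c*p*2 (valueFrom-suc (suc j) cs) ⟩
  c ℕ.* 2 ℕ.^ j ℕ.* 2 + valueFrom (suc j) cs ℕ.* 2  ≡⟨ sym (ℕₚ.*-distribʳ-+ 2 (c ℕ.* 2 ℕ.^ j) _) ⟩
  (c ℕ.* 2 ℕ.^ j + valueFrom (suc j) cs) ℕ.* 2      ∎
  where
  c*[2*p]≡c*p*2 : c ℕ.* (2 ℕ.* 2 ℕ.^ j) ≡ c ℕ.* 2 ℕ.^ j ℕ.* 2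
  c*[2*p]≡c*p*2 = trans (cong (c ℕ.*_) (ℕₚ.*-comm 2 (2 ℕ.^ j))) (sym (ℕₚ.*-assoc c (2 ℕ.^ j) 2))

withLowDigit : List ℕ → List (List ℕ)
withLowDigit cs = (0 ∷ cs) ∷ (1 ∷ cs) ∷ (2 ∷ cs) ∷ []

module Hyperbinary (q : ℚ) where

  weight : ℕ → List ℕ → ℚ
  weight n cs = if valueFrom 0 cs ≡ᵇ n then q ^ℚ sum cs else 0ℚ

  weight⁻ : ℕ → List ℕ → ℚ
  weight⁻ zero    cs = 0ℚ
  weight⁻ (suc n) cs = q * (q * weight n cs)

  hBelow : ℕ → ℕ → ℚ
  hBelow k n = ∑ (mults k) (weight n)

  hBelow⁻ : ℕ → ℕ → ℚ
  hBelow⁻ k zero    = 0ℚ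
  hBelow⁻ k (suc n) = q * (q * hBelow k n)

  weight-digit : ∀ c cs n {b} → (c + valueFrom 0 cs ℕ.* 2 ≡ᵇ n) ≡ b →
                 weight n (c ∷ cs) ≡ (if b then q ^ℚ (c + sum cs) else 0ℚ)
  weight-digit c cs n refl =
    cong (λ m → if m ≡ᵇ n then q ^ℚ (c + sum cs) else 0ℚ)
         (cong₂ _+_ (ℕₚ.*-identityʳ c) (valueFrom-suc 0 cs))

  withLowDigit-odd : ∀ v cs → ∑ (withLowDigit cs) (weight (suc (v ℕ.* 2))) ≡ q * weight v cs
  withLowDigit-odd v cs = begin
      weight n (0 ∷ cs) +ℚ (weight n (1 ∷ cs) +ℚ (weight n (2 ∷ cs) +ℚ 0ℚ))
    ≡⟨ cong₂ _+ℚ_ (weight-digit 0 cs n (*2≡ᵇ1+*2 x v))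
                  (cong₂ _+ℚ_ (weight-digit 1 cs n (*2≡ᵇ*2 x v))
                              (cong (_+ℚ 0ℚ) (weight-digit 2 cs n (1+*2≡ᵇ*2 x v)))) ⟩
      0ℚ +ℚ ((if x ≡ᵇ v then q * q ^ℚ sum cs else 0ℚ) +ℚ (0ℚ +ℚ 0ℚ))
    ≡⟨ solve 1 (λ y → con 0ℚ :+ (y :+ (con 0ℚ :+ con 0ℚ)) := y) refl _ ⟩
      (if x ≡ᵇ v then q * q ^ℚ sum cs else 0ℚ)
    ≡⟨ if-*ˡ (x ≡ᵇ v) q _ ⟩
      q * weight v cs ∎
    where
    n = suc (v ℕ.* 2)
    x = valueFrom 0 cs

  withLowDigit-double : ∀ v cs → ∑ (withLowDigit cs) (weight (v ℕ.* 2)) ≡ weight v cs +ℚ weight⁻ v cs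
  withLowDigit-double v cs = begin
      weight n (0 ∷ cs) +ℚ (weight n (1 ∷ cs) +ℚ (weight n (2 ∷ cs) +ℚ 0ℚ))
    ≡⟨ cong₂ _+ℚ_ (weight-digit 0 cs n (*2≡ᵇ*2 x v))
                  (cong₂ _+ℚ_ (weight-digit 1 cs n (1+*2≡ᵇ*2 x v)) (cong (_+ℚ 0ℚ) (digit-2 v))) ⟩
      weight v cs +ℚ (0ℚ +ℚ (weight⁻ v cs +ℚ 0ℚ))
    ≡⟨ solve 2 (λ y z → y :+ (con 0ℚ :+ (z :+ con 0ℚ)) := y :+ z) refl (weight v cs) (weight⁻ v cs) ⟩
      weight v cs +ℚ weight⁻ v cs ∎
    where
    n = v ℕ.* 2
    x = valueFrom 0 cs
    digit-2 : ∀ v → weight (v ℕ.* 2) (2 ∷ cs) ≡ weight⁻ v cs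
    digit-2 zero    = weight-digit 2 cs 0 refl
    digit-2 (suc v) = begin
      weight (suc v ℕ.* 2) (2 ∷ cs)                   ≡⟨ weight-digit 2 cs (suc v ℕ.* 2) (*2≡ᵇ*2 x v) ⟩
      (if x ≡ᵇ v then q * (q * q ^ℚ sum cs) else 0ℚ)  ≡⟨ if-*ˡ (x ≡ᵇ v) q _ ⟩
      q * (if x ≡ᵇ v then q * q ^ℚ sum cs else 0ℚ)    ≡⟨ cong (q *_) (if-*ˡ (x ≡ᵇ v) q _) ⟩
      q * (q * weight v cs)                            ∎

  hBelow-odd : ∀ k v → hBelow (suc k) (suc (v ℕ.* 2)) ≡ q * hBelow k v
  hBelow-odd k v = begin
    hBelow (suc k) (suc (v ℕ.* 2))                    ≡⟨ ∑-concatMap withLowDigit (mults k) _ ⟩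
    ∑[ cs ← mults k ] ∑ (withLowDigit cs) (weight _)  ≡⟨ ∑-cong (mults k) (withLowDigit-odd v) ⟩
    ∑[ cs ← mults k ] (q * weight v cs)               ≡⟨ ∑-*ˡ q (mults k) (weight v) ⟩
    q * hBelow k v                                    ∎

  ∑-weight⁻ : ∀ k v → ∑ (mults k) (weight⁻ v) ≡ hBelow⁻ k v
  ∑-weight⁻ k zero    = ∑-zero (mults k)
  ∑-weight⁻ k (suc v) = trans (∑-*ˡ q (mults k) _) (cong (q *_) (∑-*ˡ q (mults k) (weight v)))

  hBelow-double : ∀ k v → hBelow (suc k) (v ℕ.* 2) ≡ hBelow k v +ℚ hBelow⁻ k v
  hBelow-double k v = begin
    hBelow (suc k) (v ℕ.* 2)                          ≡⟨ ∑-concatMap withLowDigit (mults k) _ ⟩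
    ∑[ cs ← mults k ] ∑ (withLowDigit cs) (weight _)  ≡⟨ ∑-cong (mults k) (withLowDigit-double v) ⟩
    ∑[ cs ← mults k ] (weight v cs +ℚ weight⁻ v cs)   ≡⟨ ∑-+ (mults k) (weight v) (weight⁻ v) ⟩
    hBelow k v +ℚ ∑ (mults k) (weight⁻ v)             ≡⟨ cong (hBelow k v +ℚ_) (∑-weight⁻ k v) ⟩
    hBelow k v +ℚ hBelow⁻ k v                         ∎

  hBelow⁻-double : ∀ k v → hBelow⁻ (suc k) (v ℕ.* 2) ≡ q * hBelow⁻ k v
  hBelow⁻-double k zero    = sym (ℚₚ.*-zeroʳ q)
  hBelow⁻-double k (suc v) = cong (λ x → q * (q * x)) (hBelow-odd k v)

  hBelow-zero : ∀ k → hBelow k 0 ≡ 1ℚ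
  hBelow-zero zero    = ℚₚ.+-identityʳ 1ℚ
  hBelow-zero (suc k) = trans (hBelow-double k 0) (trans (ℚₚ.+-identityʳ _) (hBelow-zero k))

  -- For a least-significant-first digit list L of value n, hᵇ L = h(n) and
  -- hᵇ⁻ L = q² h(n-1), with h(-1) = 0.
  mutual
    hᵇ : List Bool → ℚ
    hᵇ []          = 1ℚ
    hᵇ (true  ∷ L) = q * hᵇ L
    hᵇ (false ∷ L) = hᵇ L +ℚ hᵇ⁻ L

    hᵇ⁻ : List Bool → ℚ
    hᵇ⁻ []          = 0ℚ
    hᵇ⁻ (true  ∷ L) = q * (q * (hᵇ L +ℚ hᵇ⁻ L))
    hᵇ⁻ (false ∷ L) = q * hᵇ⁻ L

  hBelow-fromBits : ∀ {k} L → length L ≤ k →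
                    hBelow k (fromBits L) ≡ hᵇ L × hBelow⁻ k (fromBits L) ≡ hᵇ⁻ L
  hBelow-fromBits {k} [] _ = hBelow-zero k , refl
  hBelow-fromBits {suc k} (true ∷ L) (s≤s |L|≤k) with hBelow-fromBits L |L|≤k
  ... | eq , eq⁻ = trans (hBelow-odd k (fromBits L)) (cong (q *_) eq)
                 , cong (λ x → q * (q * x)) (trans (hBelow-double k (fromBits L)) (cong₂ _+ℚ_ eq eq⁻))
  hBelow-fromBits {suc k} (false ∷ L) (s≤s |L|≤k) with hBelow-fromBits L |L|≤k
  ... | eq , eq⁻ = trans (hBelow-double k (fromBits L)) (cong₂ _+ℚ_ eq eq⁻)
                 , trans (hBelow⁻-double k (fromBits L)) (cong (q *_) eq⁻)

  h≡hᵇ : ∀ n → h q n ≡ hᵇ (βʳ n)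
  h≡hᵇ n = begin
    h q n                            ≡⟨ ∑-filter _ (mults (suc n)) _ ⟩
    hBelow (suc n) n                 ≡⟨ cong (hBelow (suc n)) (sym (fromBits-revBitsF n n ℕₚ.≤-refl)) ⟩
    hBelow (suc n) (fromBits (βʳ n)) ≡⟨ proj₁ (hBelow-fromBits (βʳ n) |βʳn|≤1+n) ⟩
    hᵇ (βʳ n)                        ∎
    where
    |βʳn|≤1+n = ℕₚ.m≤n⇒m≤1+n (length-revBitsF n n)

-- isIdeal drops the cover condition b₁, which is vacuous for x₀ ∈ I when b₁ = 1.
isIdeal-noLeadingZero : ∀ {w} → NoLeadingZero w → ∀ I → isIdeal w I ≡ isIdealFrom true w I
isIdeal-noLeadingZero []     I           = refl
isIdeal-noLeadingZero (1∷ w) []          = refl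
isIdeal-noLeadingZero (1∷ w) (false ∷ I) = refl
isIdeal-noLeadingZero (1∷ w) (true  ∷ I) = refl

does-≟-true : ∀ b → does (b ≟ true) ≡ b
does-≟-true false = refl
does-≟-true true  = refl

module Fence (t : ℚ) where

  extend : Bool → (Bool → ℚ) → Bool → ℚ
  extend b v a = (if coverOK b a false then v false else 0ℚ) +ℚ (if coverOK b a true then t * v true else 0ℚ)

  -- fence (b₁ ⋯ b_r) v a = Σ t^|I| v(c) over the I ⊆ {x₁, …, x_r} satisfying all the cover
  -- conditions b₁, …, b_r, the one for b₁ relative to a virtual x₀ that lies in I iff a;
  -- c tells whether x_r ∈ I (c = a if r = 0).
  fence : List Bool → (Bool → ℚ) → Bool → ℚ
  fence w v = foldr extend v w

  fence-reverse-∷ : ∀ b L v → fence (reverse (b ∷ L)) v ≡ fence (reverse L) (extend b v)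
  fence-reverse-∷ b L v = trans (cong (λ w → fence w v) (unfold-reverse b L)) (foldr-∷ʳ extend v b (reverse L))

  idealWeight : Bool → List Bool → List Bool → ℚ
  idealWeight a w s = if isIdealFrom a w s then t ^ℚ ones s else 0ℚ

  ∑-idealWeight : ∀ a w → ∑ (subsets (length w)) (idealWeight a w) ≡ fence w (λ _ → 1ℚ) a
  ∑-idealWeight a []      = ℚₚ.+-identityʳ 1ℚ
  ∑-idealWeight a (b ∷ w) = begin
      ∑ (subsets (suc (length w))) (idealWeight a (b ∷ w))
    ≡⟨ ∑-concatMap _ S _ ⟩
      ∑[ s ← S ] (idealWeight a (b ∷ w) (false ∷ s) +ℚ (idealWeight a (b ∷ w) (true ∷ s) +ℚ 0ℚ))
    ≡⟨ ∑-cong S split ⟩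
      ∑[ s ← S ] ((if cF then idealWeight false w s else 0ℚ) +ℚ (if cT then t * idealWeight true w s else 0ℚ))
    ≡⟨ ∑-+ S _ _ ⟩
      ∑[ s ← S ] (if cF then idealWeight false w s else 0ℚ)
        +ℚ ∑[ s ← S ] (if cT then t * idealWeight true w s else 0ℚ)
    ≡⟨ cong₂ _+ℚ_ (∑-if cF S _) (∑-if cT S _) ⟩
      (if cF then ∑ S (idealWeight false w) else 0ℚ)
        +ℚ (if cT then ∑[ s ← S ] (t * idealWeight true w s) else 0ℚ)
    ≡⟨ cong₂ _+ℚ_ (cong (λ x → if cF then x else 0ℚ) (∑-idealWeight false w))
                  (cong (λ x → if cT then x else 0ℚ)
                        (trans (∑-*ˡ t S _) (cong (t *_) (∑-idealWeight true w)))) ⟩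
      extend b (fence w (λ _ → 1ℚ)) a ∎
    where
    S = subsets (length w)
    cF = coverOK b a false
    cT = coverOK b a true
    split : ∀ s → idealWeight a (b ∷ w) (false ∷ s) +ℚ (idealWeight a (b ∷ w) (true ∷ s) +ℚ 0ℚ)
                ≡ (if cF then idealWeight false w s else 0ℚ) +ℚ (if cT then t * idealWeight true w s else 0ℚ)
    split s = cong₂ _+ℚ_ (if-∧ cF _ _)
                (trans (ℚₚ.+-identityʳ _)
                  (trans (if-∧ cT _ _) (cong (λ x → if cT then x else 0ℚ) (if-*ˡ (isIdealFrom true w s) t _))))

  rgf≡fence : ∀ n → rgf n t ≡ fence (principalPrefix (β n)) (λ _ → 1ℚ) true
  rgf≡fence n = begin
      rgf n t
    ≡⟨ ∑-filter _ (subsets (length w)) _ ⟩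
      ∑[ I ← subsets (length w) ] (if does (isIdeal w I ≟ true) then t ^ℚ ones I else 0ℚ)
    ≡⟨ ∑-cong (subsets (length w)) (λ I → cong (λ c → if c then t ^ℚ ones I else 0ℚ)
                                               (trans (does-≟-true _) (isIdeal-noLeadingZero nlz I))) ⟩
      ∑ (subsets (length w)) (idealWeight true w)
    ≡⟨ ∑-idealWeight true w ⟩
      fence w (λ _ → 1ℚ) true ∎
    where
    w = principalPrefix (β n)
    nlz = noLeadingZero-principalPrefix (β-noLeadingZero n)

module Duality (q t : ℚ) (q*t≡1 : q * t ≡ 1ℚ) where
  open Hyperbinary q
  open Fence t

  cancel-q*t : ∀ x u → x * ((q * t) * u) ≡ x * u
  cancel-q*t x u = cong (x *_) (trans (cong (_* u) q*t≡1) (ℚₚ.*-identityˡ u))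

  -- q^(1+b) N_b = M_bᵀ, iterated along L.
  fence-reverse≡hᵇ : ∀ L v → q ^ℚ (length L + ones L) * fence (reverse L) v true
                             ≡ hᵇ L * v true +ℚ hᵇ⁻ L * v false
  fence-reverse≡hᵇ [] v =
    solve 2 (λ x y → con 1ℚ :* x := con 1ℚ :* x :+ con 0ℚ :* y) refl (v true) (v false)
  fence-reverse≡hᵇ (true ∷ L) v = begin
      q ^ℚ (suc (length L + suc (ones L))) * fence (reverse (true ∷ L)) v true
    ≡⟨ cong₂ _*_ (cong (λ e → q ^ℚ suc e) (ℕₚ.+-suc (length L) (ones L)))
                 (cong-app (fence-reverse-∷ true L v) true) ⟩
      q * (q * E) * fence (reverse L) v′ true
    ≡⟨ trans (ℚₚ.*-assoc q _ _) (cong (q *_) (ℚₚ.*-assoc q E _)) ⟩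
      q * (q * (E * fence (reverse L) v′ true))
    ≡⟨ cong (λ x → q * (q * x)) (fence-reverse≡hᵇ L v′) ⟩
      q * (q * (hᵇ L * (v false +ℚ t * v true) +ℚ hᵇ⁻ L * (v false +ℚ 0ℚ)))
    ≡⟨ solve 6 (λ q t h h⁻ f u → q :* (q :* (h :* (f :+ t :* u) :+ h⁻ :* (f :+ con 0ℚ)))
                              := (q :* h) :* ((q :* t) :* u) :+ (q :* (q :* (h :+ h⁻))) :* f)
               refl q t (hᵇ L) (hᵇ⁻ L) (v false) (v true) ⟩
      q * hᵇ L * ((q * t) * v true) +ℚ q * (q * (hᵇ L +ℚ hᵇ⁻ L)) * v false
    ≡⟨ cong (_+ℚ _) (cancel-q*t (q * hᵇ L) (v true)) ⟩
      q * hᵇ L * v true +ℚ q * (q * (hᵇ L +ℚ hᵇ⁻ L)) * v false ∎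
    where
    E = q ^ℚ (length L + ones L)
    v′ = extend true v
  fence-reverse≡hᵇ (false ∷ L) v = begin
      q * E * fence (reverse (false ∷ L)) v true
    ≡⟨ cong (q * E *_) (cong-app (fence-reverse-∷ false L v) true) ⟩
      q * E * fence (reverse L) v′ true
    ≡⟨ ℚₚ.*-assoc q E _ ⟩
      q * (E * fence (reverse L) v′ true)
    ≡⟨ cong (q *_) (fence-reverse≡hᵇ L v′) ⟩
      q * (hᵇ L * (0ℚ +ℚ t * v true) +ℚ hᵇ⁻ L * (v false +ℚ t * v true))
    ≡⟨ solve 6 (λ q t h h⁻ f u → q :* (h :* (con 0ℚ :+ t :* u) :+ h⁻ :* (f :+ t :* u))
                              := (h :+ h⁻) :* ((q :* t) :* u) :+ (q :* h⁻) :* f)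
               refl q t (hᵇ L) (hᵇ⁻ L) (v false) (v true) ⟩
      (hᵇ L +ℚ hᵇ⁻ L) * ((q * t) * v true) +ℚ q * hᵇ⁻ L * v false
    ≡⟨ cong (_+ℚ _) (cancel-q*t (hᵇ L +ℚ hᵇ⁻ L) (v true)) ⟩
      (hᵇ L +ℚ hᵇ⁻ L) * v true +ℚ q * hᵇ⁻ L * v false ∎
    where
    E = q ^ℚ (length L + ones L)
    v′ = extend false v

  hᵇ≡fence-ppRev : ∀ L → hᵇ L ≡ q ^ℚ (length (ppRev L) + ones L)
                                   * fence (reverse (ppRev L)) (λ _ → 1ℚ) true
  hᵇ≡fence-ppRev []          = sym (ℚₚ.*-identityˡ 1ℚ)
  hᵇ≡fence-ppRev (true ∷ L)  = begin
      q * hᵇ L                 ≡⟨ cong (q *_) (hᵇ≡fence-ppRev L) ⟩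
      q * (q ^ℚ e * F)         ≡⟨ sym (ℚₚ.*-assoc q _ F) ⟩
      q ^ℚ suc e * F           ≡⟨ cong (λ e → q ^ℚ e * F) (sym (ℕₚ.+-suc (length (ppRev L)) (ones L))) ⟩
      q ^ℚ (length (ppRev L) + suc (ones L)) * F ∎
    where
    e = length (ppRev L) + ones L
    F = fence (reverse (ppRev L)) (λ _ → 1ℚ) true
  hᵇ≡fence-ppRev (false ∷ L) = begin
      hᵇ L +ℚ hᵇ⁻ L
    ≡⟨ sym (cong₂ _+ℚ_ (ℚₚ.*-identityʳ (hᵇ L)) (ℚₚ.*-identityʳ (hᵇ⁻ L))) ⟩
      hᵇ L * 1ℚ +ℚ hᵇ⁻ L * 1ℚ
    ≡⟨ sym (fence-reverse≡hᵇ L (λ _ → 1ℚ)) ⟩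
      q ^ℚ (length L + ones L) * fence (reverse L) (λ _ → 1ℚ) true ∎

  hᵇ≡fence-principalPrefix : ∀ L → hᵇ L ≡ q ^ℚ (length (principalPrefix (reverse L)) + ones (reverse L))
                                     * fence (principalPrefix (reverse L)) (λ _ → 1ℚ) true
  hᵇ≡fence-principalPrefix L
    rewrite principalPrefix-reverse L | length-reverse (ppRev L) | ones-reverse L = hᵇ≡fence-ppRev L

theorem3p17 : (n : ℕ) (q : ℚ) .{{_ : NonZero q}} →
    h q n ≡ q ^ℚ (length (principalPrefix (β n)) + ones (β n)) * rgf n (1/ q)
theorem3p17 n q = begin
    h q n                                                   ≡⟨ h≡hᵇ n ⟩
    hᵇ (βʳ n)                                               ≡⟨ hᵇ≡fence-principalPrefix (βʳ n) ⟩
    q ^ℚ e * fence (principalPrefix (β n)) (λ _ → 1ℚ) true  ≡⟨ cong (q ^ℚ e *_) (sym (rgf≡fence n)) ⟩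
    q ^ℚ e * rgf n (1/ q)                                   ∎
  where
  e = length (principalPrefix (β n)) + ones (β n)
  open Hyperbinary q
  open Fence (1/ q)
  open Duality q (1/ q) (ℚₚ.*-inverseʳ q)
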